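{- Let $\mathbf{L}=\langle L,\wedge,\vee,\otimes,\rightarrow,0,1\rangle$ be a complete residuated lattice and let $F$ be a type (a set of function symbols with finite arities). Let $\mathbf{M}=\langle M,\approx^{\mathbf{M}},F^{\mathbf{M}}\rangle$ be an algebra with $\mathbf{L}$-equality of type $F$, and let $\preccurlyeq^{\mathbf{M}}$ be a binary $\mathbf{L}$-relation on $M$ such that for all $a,b,c,a_1,b_1,\dots,a_n,b_n\in M$ and every $n$-ary $f\in F$: (i) $a\preccurlyeq^{\mathbf{M}} a=1$; (ii) $(a\preccurlyeq^{\mathbf{M}} b)\wedge(b\preccurlyeq^{\mathbf{M}} a)\le a\approx^{\mathbf{M}} b$; (iii) $(a\preccurlyeq^{\mathbf{M}} b)\otimes(b\preccurlyeq^{\mathbf{M}} c)\le a\preccurlyeq^{\mathbf{M}} c$; (iv) $(a_1\preccurlyeq^{\mathbf{M}} b_1)\otimes\cdots\otimes(a_n\preccurlyeq^{\mathbf{M}} b_n)\le f^{\mathbf{M}}(a_1,\dots,a_n)\preccurlyeq^{\mathbf{M}} f^{\mathbf{M}}(b_1,\dots,b_n)$. Then the following are equivalent: (1) $\langle M,\approx^{\mathbf{M}},\preccurlyeq^{\mathbf{M}},F^{\mathbf{M}}\rangle$ is an algebra with $\mathbf{L}$-equality and $\mathbf{L}$-order; (2) for all $a_1,a_2,b_1,b_2\in M$: $(a_1\approx^{\mathbf{M}} b_1)\otimes(a_2\approx^{\mathbf{M}} b_2)\le (a_1\preccurlyeq^{\mathbf{M}} a_2)\rightarrow(b_1\preccurlyeq^{\mathbf{M}}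 b_2)$; (3) $\approx^{\mathbf{M}}\subseteq\preccurlyeq^{\mathbf{M}}$; (4) $\approx^{\mathbf{M}}=\preccurlyeq^{\mathbf{M}}\cap\succcurlyeq^{\mathbf{M}}$; (5) $\approx^{\mathbf{M}}$ is the symmetric interior of $\preccurlyeq^{\mathbf{M}}$.
   Context: A complete residuated lattice is an algebra $\langle L,\wedge,\vee,\otimes,\rightarrow,0,1\rangle$ where $\langle L,\wedge,\vee,0,1\rangle$ is a complete lattice, $\langle L,\otimes,1\rangle$ is a commutative monoid, and $a\otimes b\le c$ iff $a\le b\rightarrow c$. A binary $\mathbf{L}$-relation on $M\neq\emptyset$ is a map $R:M\times M\to L$, written infix; $R_1\subseteq R_2$ means $R_1(a,b)\le R_2(a,b)$ for all $a,b$; $R^{ -1}(a,b)=R(b,a)$, and the inverse of $\preccurlyeq$ is denoted $\succcurlyeq$; $(R_1\cap R_2)(a,b)=R_1(a,b)\wedge R_2(a,b)$. An $\mathbf{L}$-relation $R$ is symmetric if $R=R^{ -1}$; the symmetric interior of $R$ is the largest symmetric $\mathbf{L}$-relation contained in $R$. An algebra with $\mathbf{L}$-equality of type $F$ is $\langle M,\approx^{\mathbf{M}},F^{\mathbf{M}}\rangle$ where $\langle M,F^{\mathbf{M}}\rangle$ is an ordinary algebra of type $F$ and $\approx^{\mathbf{M}}$ is a binary $\mathbf{L}$-relation on $M$ with: $a\approx^{\mathbf{M}} b=1$ iff $a=b$; $a\approx^{\mathbf{M}} b=b\approx^{\mathbf{M}} a$; $(a\approx^{\mathbf{M}} b)\otimes(b\approx^{\mathbf{M}}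 c)\le a\approx^{\mathbf{M}} c$; and $(a_1\approx^{\mathbf{M}} b_1)\otimes\cdots\otimes(a_n\approx^{\mathbf{M}} b_n)\le f^{\mathbf{M}}(a_1,\dots,a_n)\approx^{\mathbf{M}} f^{\mathbf{M}}(b_1,\dots,b_n)$ for every $n$-ary $f\in F$. A structure $\langle M,\approx^{\mathbf{M}},\preccurlyeq^{\mathbf{M}},F^{\mathbf{M}}\rangle$ is an algebra with $\mathbf{L}$-equality and $\mathbf{L}$-order if $\langle M,\approx^{\mathbf{M}},F^{\mathbf{M}}\rangle$ is an algebra with $\mathbf{L}$-equality and $\preccurlyeq^{\mathbf{M}}$ satisfies conditions (i)–(iv) of the claim together with condition (2) of the claim. -}

module Defs where

open import Level using (Level; _⊔_) renaming (suc to lsuc)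
open import Data.Nat using (ℕ; zero) renaming (suc to sucℕ)
open import Data.Fin using (Fin; zero; suc)
open import Data.Product using (_×_; Σ)
open import Relation.Binary.PropositionalEquality using (_≡_)
open import Relation.Binary.Structures using (IsPartialOrder)
open import Relation.Unary using (Pred; _∈_)

record CompleteResiduatedLattice (c ℓ : Level) : Set (lsuc (c ⊔ ℓ)) where
  infixr 7 _⊗_
  infixr 6 _∧_
  infixr 5 _∨_
  infixr 4 _⇒_
  infix 2 _≤_
  field
    Carrier : Set c
    _≤_     : Carrier → Carrier → Set ℓ
    _∧_ _∨_ _⊗_ _⇒_ : Carrier → Carrier → Carrier
    𝟘 𝟙     : Carrier
    ⋀ ⋁     : Pred Carrier c → Carrier
    isPartialOrder : IsPartialOrder _≡_ _≤_
    ∧-lb₁ : ∀ x y → x ∧ y ≤ x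
    ∧-lb₂ : ∀ x y → x ∧ y ≤ y
    ∧-glb : ∀ x y z → z ≤ x → z ≤ y → z ≤ x ∧ y
    ∨-ub₁ : ∀ x y → x ≤ x ∨ y
    ∨-ub₂ : ∀ x y → y ≤ x ∨ y
    ∨-lub : ∀ x y z → x ≤ z → y ≤ z → x ∨ y ≤ z
    𝟘-min : ∀ x → 𝟘 ≤ x
    𝟙-max : ∀ x → x ≤ 𝟙
    ⋀-lb  : ∀ (S : Pred Carrier c) x → x ∈ S → ⋀ S ≤ x
    ⋀-glb : ∀ (S : Pred Carrier c) z → (∀ x → x ∈ S → z ≤ x) → z ≤ ⋀ S
    ⋁-ub  : ∀ (S : Pred Carrier c) x → x ∈ S → x ≤ ⋁ S
    ⋁-lub : ∀ (S : Pred Carrier c) z → (∀ x → x ∈ S → x ≤ z) → ⋁ S ≤ z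
    ⊗-assoc : ∀ x y z → (x ⊗ y) ⊗ z ≡ x ⊗ (y ⊗ z)
    ⊗-comm  : ∀ x y → x ⊗ y ≡ y ⊗ x
    ⊗-identityˡ : ∀ x → 𝟙 ⊗ x ≡ x
    residuation₁ : ∀ a b c → a ⊗ b ≤ c → a ≤ b ⇒ c
    residuation₂ : ∀ a b c → a ≤ b ⇒ c → a ⊗ b ≤ c

record Signature (s : Level) : Set (lsuc s) where
  field
    Sym   : Set s
    arity : Sym → ℕ

module Theory {c ℓ s m : Level}
  (𝐋 : CompleteResiduatedLattice c ℓ) (F : Signature s) where
  open CompleteResiduatedLattice 𝐋
  open Signature F

  LRel : Set m → Set (c ⊔ m)
  LRel M = M → M → Carrier

  Interp : Set m → Set (s ⊔ m)
  Interp M = (f : Sym) → (Fin (arity f) → M) → M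

  ⨂ : ∀ {n} → (Fin n → Carrier) → Carrier
  ⨂ {zero}   g = 𝟙
  ⨂ {sucℕ n} g = g zero ⊗ ⨂ (λ i → g (suc i))

  module _ {M : Set m} where
    _⊆_ : LRel M → LRel M → Set (m ⊔ ℓ)
    R ⊆ S = ∀ a b → R a b ≤ S a b

    _⁻¹ : LRel M → LRel M
    (R ⁻¹) a b = R b a

    _∩_ : LRel M → LRel M → LRel M
    (R ∩ S) a b = R a b ∧ S a b

    _≐_ : LRel M → LRel M → Set (c ⊔ m)
    R ≐ S = ∀ a b → R a b ≡ S a b

    Symmetric : LRel M → Set (c ⊔ m)
    Symmetric R = R ≐ (R ⁻¹)

    IsSymmetricInterior : LRel M → LRel M → Set (c ⊔ ℓ ⊔ m)
    IsSymmetricInterior S R =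
      Symmetric S × S ⊆ R × (∀ (T : LRel M) → Symmetric T → T ⊆ R → T ⊆ S)

    IsLEqAlgebra : LRel M → Interp M → Set (c ⊔ ℓ ⊔ s ⊔ m)
    IsLEqAlgebra _≈_ ⟦_⟧ =
      (∀ a b → (a ≈ b ≡ 𝟙 → a ≡ b) × (a ≡ b → a ≈ b ≡ 𝟙)) ×
      (∀ a b → a ≈ b ≡ b ≈ a) ×
      (∀ a b c → (a ≈ b) ⊗ (b ≈ c) ≤ a ≈ c) ×
      (∀ (f : Sym) (as bs : Fin (arity f) → M) →
         ⨂ (λ i → as i ≈ bs i) ≤ ⟦ f ⟧ as ≈ ⟦ f ⟧ bs)

    Cond-i : LRel M → Set (c ⊔ m)
    Cond-i _≼_ = ∀ a → a ≼ a ≡ 𝟙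

    Cond-ii : LRel M → LRel M → Set (ℓ ⊔ m)
    Cond-ii _≈_ _≼_ = ∀ a b → (a ≼ b) ∧ (b ≼ a) ≤ a ≈ b

    Cond-iii : LRel M → Set (ℓ ⊔ m)
    Cond-iii _≼_ = ∀ a b c → (a ≼ b) ⊗ (b ≼ c) ≤ a ≼ c

    Cond-iv : LRel M → Interp M → Set (ℓ ⊔ s ⊔ m)
    Cond-iv _≼_ ⟦_⟧ = ∀ (f : Sym) (as bs : Fin (arity f) → M) →
      ⨂ (λ i → as i ≼ bs i) ≤ ⟦ f ⟧ as ≼ ⟦ f ⟧ bs

    Compatible : LRel M → LRel M → Set (ℓ ⊔ m)
    Compatible _≈_ _≼_ = ∀ a₁ a₂ b₁ b₂ →
      (a₁ ≈ b₁) ⊗ (a₂ ≈ b₂) ≤ (a₁ ≼ a₂) ⇒ (b₁ ≼ b₂)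

    IsLEqOrdAlgebra : LRel M → LRel M → Interp M → Set (c ⊔ ℓ ⊔ s ⊔ m)
    IsLEqOrdAlgebra _≈_ _≼_ ⟦_⟧ =
      IsLEqAlgebra _≈_ ⟦_⟧ × Cond-i _≼_ × Cond-ii _≈_ _≼_ × Cond-iii _≼_ ×
      Cond-iv _≼_ ⟦_⟧ × Compatible _≈_ _≼_

-- Since ≈ is reflexive and ≼ is transitive, compatibility (2) specialised to
-- a₁ = a₂ = b₁ gives ≈ ⊆ ≼; conversely ≈ ⊆ ≼ and symmetry of ≈ let one pass
-- from a₁ ≼ a₂ to b₁ ≼ b₂ through b₁ ≼ a₁ ≼ a₂ ≼ b₂. With ≈ ⊆ ≼, condition (ii)
-- pins ≈ down to ≼ ∩ ≽, which is the symmetric interior of any L-relation ≼.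
module Submission where

open import Defs
open import Level using (Level; _⊔_)
open import Data.Product using (_×_; _,_; proj₂)
open import Function.Bundles using (_⇔_; mk⇔)
open import Relation.Binary.Bundles using (Poset)
open import Relation.Binary.PropositionalEquality using (_≡_; refl; sym; trans; cong; cong₂)
import Relation.Binary.Reasoning.PartialOrder as PosetReasoning

module ResiduatedLatticeProperties {c ℓ : Level} (𝐋 : CompleteResiduatedLattice c ℓ) where
  open CompleteResiduatedLattice 𝐋

  poset : Poset c c ℓ
  poset = record { isPartialOrder = isPartialOrder }

  open Poset poset public using (antisym; reflexive) renaming (refl to ≤-refl; trans to ≤-trans)
  open PosetReasoning poset public

  ⊗-identityʳ : ∀ x → x ⊗ 𝟙 ≡ x
  ⊗-identityʳ x = trans (⊗-comm x 𝟙) (⊗-identityˡ x)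

  ⊗-monoˡ : ∀ z {x y} → x ≤ y → x ⊗ z ≤ y ⊗ z
  ⊗-monoˡ z {x} {y} x≤y =
    residuation₂ x z (y ⊗ z) (≤-trans x≤y (residuation₁ y z (y ⊗ z) ≤-refl))

  ⊗-monoʳ : ∀ z {x y} → x ≤ y → z ⊗ x ≤ z ⊗ y
  ⊗-monoʳ z {x} {y} x≤y = begin
    z ⊗ x  ≡⟨ ⊗-comm z x ⟩
    x ⊗ z  ≤⟨ ⊗-monoˡ z x≤y ⟩
    y ⊗ z  ≡⟨ ⊗-comm y z ⟩
    z ⊗ y  ∎

  ⊗-mono : ∀ {x x′ y y′} → x ≤ x′ → y ≤ y′ → x ⊗ y ≤ x′ ⊗ y′
  ⊗-mono {x′ = x′} {y = y} x≤x′ y≤y′ = ≤-trans (⊗-monoˡ y x≤x′) (⊗-monoʳ x′ y≤y′)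

  ∧-comm : ∀ x y → x ∧ y ≡ y ∧ x
  ∧-comm x y = antisym (swap x y) (swap y x)
    where
    swap : ∀ x y → x ∧ y ≤ y ∧ x
    swap x y = ∧-glb y x (x ∧ y) (∧-lb₂ x y) (∧-lb₁ x y)

module LRelationProperties {c ℓ s m : Level}
  (𝐋 : CompleteResiduatedLattice c ℓ) (F : Signature s) {M : Set m} where
  open CompleteResiduatedLattice 𝐋
  open ResiduatedLatticeProperties 𝐋
  open Theory {c} {ℓ} {s} {m} 𝐋 F

  Reflexive : LRel M → Set (c ⊔ m)
  Reflexive R = ∀ a → R a a ≡ 𝟙

  ≐⇒⊆ : ∀ {R S : LRel M} → R ≐ S → R ⊆ S
  ≐⇒⊆ R≐S a b = reflexive (R≐S a b)

  ≐-sym : ∀ {R S : LRel M} → R ≐ S → S ≐ R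
  ≐-sym R≐S a b = sym (R≐S a b)

  ⊆-swap : ∀ {R S : LRel M} → Symmetric R → R ⊆ S → R ⊆ (S ⁻¹)
  ⊆-swap {R} {S} symR R⊆S a b = begin
    R a b  ≡⟨ symR a b ⟩
    R b a  ≤⟨ R⊆S b a ⟩
    S b a  ∎

  ⊆-∩⁻¹ : ∀ {R S : LRel M} → Symmetric R → R ⊆ S → R ⊆ (S ∩ (S ⁻¹))
  ⊆-∩⁻¹ symR R⊆S a b = ∧-glb _ _ _ (R⊆S a b) (⊆-swap symR R⊆S a b)

  ∩⁻¹-isSymmetricInterior : ∀ (R : LRel M) → IsSymmetricInterior (R ∩ (R ⁻¹)) R
  ∩⁻¹-isSymmetricInterior R =
    (λ a b → ∧-comm (R a b) (R b a)) , (λ a b → ∧-lb₁ _ _) , λ _ → ⊆-∩⁻¹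

  symmetricInterior-unique : ∀ {S S′ R : LRel M} →
    IsSymmetricInterior S R → IsSymmetricInterior S′ R → S ≐ S′
  symmetricInterior-unique (symS , S⊆R , maxS) (symS′ , S′⊆R , maxS′) a b =
    antisym (maxS′ _ symS S⊆R a b) (maxS _ symS′ S′⊆R a b)

  isSymmetricInterior-resp-≐ : ∀ {S S′ R : LRel M} →
    S ≐ S′ → IsSymmetricInterior S R → IsSymmetricInterior S′ R
  isSymmetricInterior-resp-≐ {S} {S′} S≐S′ (symS , S⊆R , maxS) =
    symS′ , (λ a b → ≤-trans (≐⇒⊆ (≐-sym S≐S′) a b) (S⊆R a b)) ,
    λ T symT T⊆R a b → ≤-trans (maxS T symT T⊆R a b) (≐⇒⊆ S≐S′ a b)
    where
    symS′ : Symmetric S′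
    symS′ a b = begin-equality
      S′ a b  ≡⟨ S≐S′ a b ⟨
      S  a b  ≡⟨ symS a b ⟩
      S  b a  ≡⟨ S≐S′ b a ⟩
      S′ b a  ∎

  module _ {_≈_ _≼_ : LRel M} where

    compatible⇒⊆ : Reflexive _≈_ → Reflexive _≼_ →
      Compatible _≈_ _≼_ → _≈_ ⊆ _≼_
    compatible⇒⊆ ≈-refl ≼-refl compatible a b = begin
      a ≈ b                          ≡⟨ ⊗-identityʳ (a ≈ b) ⟨
      (a ≈ b) ⊗ 𝟙                    ≡⟨ cong (_⊗ 𝟙) (⊗-identityˡ (a ≈ b)) ⟨
      (𝟙 ⊗ (a ≈ b)) ⊗ 𝟙              ≡⟨ cong₂ (λ x y → (x ⊗ (a ≈ b)) ⊗ y) (≈-refl a) (≼-refl a) ⟨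
      ((a ≈ a) ⊗ (a ≈ b)) ⊗ (a ≼ a)  ≤⟨ residuation₂ _ _ _ (compatible a a a b) ⟩
      a ≼ b                          ∎

    ⊆⇒compatible : Symmetric _≈_ → Cond-iii _≼_ →
      _≈_ ⊆ _≼_ → Compatible _≈_ _≼_
    ⊆⇒compatible ≈-sym ≼-trans ≈⊆≼ a₁ a₂ b₁ b₂ = residuation₁ _ _ _ (begin
      ((a₁ ≈ b₁) ⊗ (a₂ ≈ b₂)) ⊗ (a₁ ≼ a₂)    ≡⟨ ⊗-assoc _ _ _ ⟩
      (a₁ ≈ b₁) ⊗ (a₂ ≈ b₂) ⊗ (a₁ ≼ a₂)      ≡⟨ cong ((a₁ ≈ b₁) ⊗_) (⊗-comm _ _) ⟩
      (a₁ ≈ b₁) ⊗ (a₁ ≼ a₂) ⊗ (a₂ ≈ b₂)      ≤⟨ ⊗-mono (⊆-swap ≈-sym ≈⊆≼ a₁ b₁)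
                                                   (⊗-monoʳ _ (≈⊆≼ a₂ b₂)) ⟩
      (b₁ ≼ a₁) ⊗ (a₁ ≼ a₂) ⊗ (a₂ ≼ b₂)      ≤⟨ ⊗-monoʳ _ (≼-trans a₁ a₂ b₂) ⟩
      (b₁ ≼ a₁) ⊗ (a₁ ≼ b₂)                  ≤⟨ ≼-trans b₁ a₁ b₂ ⟩
      b₁ ≼ b₂                                ∎)

    ⊆⇒≐∩⁻¹ : Symmetric _≈_ → Cond-ii _≈_ _≼_ →
      _≈_ ⊆ _≼_ → _≈_ ≐ (_≼_ ∩ (_≼_ ⁻¹))
    ⊆⇒≐∩⁻¹ ≈-sym ≼-antisym ≈⊆≼ a b = antisym (⊆-∩⁻¹ ≈-sym ≈⊆≼ a b) (≼-antisym a b)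

    ≐∩⁻¹⇒⊆ : _≈_ ≐ (_≼_ ∩ (_≼_ ⁻¹)) → _≈_ ⊆ _≼_
    ≐∩⁻¹⇒⊆ ≈≐∩ a b = ≤-trans (≐⇒⊆ ≈≐∩ a b) (∧-lb₁ _ _)

    ≐∩⁻¹⇔isSymmetricInterior :
      (_≈_ ≐ (_≼_ ∩ (_≼_ ⁻¹))) ⇔ IsSymmetricInterior _≈_ _≼_
    ≐∩⁻¹⇔isSymmetricInterior = mk⇔
      (λ ≈≐∩ → isSymmetricInterior-resp-≐ (≐-sym ≈≐∩) (∩⁻¹-isSymmetricInterior _≼_))
      (λ interior → symmetricInterior-unique interior (∩⁻¹-isSymmetricInterior _≼_))

mainTheorem1 : ∀ {c ℓ s m : Level} (𝐋 : CompleteResiduatedLattice c ℓ) (F : Signature s)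
    → let open Theory {c} {ℓ} {s} {m} 𝐋 F in
    (M : Set m) (_≈_ : LRel M) (⟦_⟧ : Interp M) (_≼_ : LRel M)
    → IsLEqAlgebra _≈_ ⟦_⟧
    → Cond-i _≼_ → Cond-ii _≈_ _≼_ → Cond-iii _≼_ → Cond-iv _≼_ ⟦_⟧
    → (IsLEqOrdAlgebra _≈_ _≼_ ⟦_⟧ ⇔ Compatible _≈_ _≼_)
    × (Compatible _≈_ _≼_ ⇔ (_≈_ ⊆ _≼_))
    × ((_≈_ ⊆ _≼_) ⇔ (_≈_ ≐ (_≼_ ∩ (_≼_ ⁻¹))))
    × ((_≈_ ≐ (_≼_ ∩ (_≼_ ⁻¹))) ⇔ IsSymmetricInterior _≈_ _≼_)
mainTheorem1 𝐋 F M _≈_ ⟦_⟧ _≼_ algebra@(≈-equality , ≈-sym , _) ≼-refl ≼-antisym ≼-trans ≼-mono =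
    mk⇔ (λ (_ , _ , _ , _ , _ , compatible) → compatible)
        (λ compatible → algebra , ≼-refl , ≼-antisym , ≼-trans , ≼-mono , compatible)
  , mk⇔ (compatible⇒⊆ ≈-refl ≼-refl) (⊆⇒compatible ≈-sym ≼-trans)
  , mk⇔ (⊆⇒≐∩⁻¹ ≈-sym ≼-antisym) ≐∩⁻¹⇒⊆
  , ≐∩⁻¹⇔isSymmetricInterior
  where
  open LRelationProperties 𝐋 F
  ≈-refl : Reflexive _≈_
  ≈-refl a = proj₂ (≈-equality a a) refl
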